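{- Let $n$ be a positive integer and let $S \subseteq \mathbb{F}_2^n \setminus \{0\}$ be a set of points such that (1) $S$ is not contained in any hyperplane of $\mathbb{F}_2^n$, (2) $S$ meets every hyperplane of $\mathbb{F}_2^n$, (3) $|S| < 2^{n-2}$. Let $f:\mathbb{F}_2^n\to\mathbb{F}_2$ be the indicator function of $S$. Then the binary code $\mathcal C_f$ is a minimal code that does not satisfy the Ashikhmin–Barg condition.
   Context: A hyperplane is an $(n-1)$-dimensional linear subspace of $\mathbb{F}_2^n$. For a function $f:\mathbb{F}_q^n\to\mathbb{F}_q$ (here $q=2$), $\mathcal C_f$ is the $\mathbb{F}_q$-subspace of $\mathbb{F}_q^{q^n-1}$ spanned by the vectors $c(u,v) = (u f(x) + v\cdot x)_{x\in \mathbb{F}_q^n\setminus\{0\}}$ for $u\in\mathbb{F}_q$, $v\in\mathbb{F}_q^n$, where $v\cdot x$ is the usual dot product. The support of a vector is the set of coordinates where it is nonzero. A linear code $\mathcal C$ is minimal if for all codewords $c,c'\in\mathcal C$, $\mathrm{supp}(c)\subseteq\mathrm{supp}(c')$ implies $c=\lambda c'$ for some $\lambda\in\mathbb{F}_q^\times$. A $q$-ary linear code satisfies the Ashikhmin–Barg condition if $w_{\max}/w_{\min} < q/(q-1)$, where $w_{\min}$ and $w_{\max}$ are the minimum and maximum Hamming weights of the nonzero codewords. -}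

module Defs where

open import Data.Bool using (Bool; true; false; _∧_; _xor_; T)
open import Data.Nat using (ℕ; zero; suc; _+_; _*_; _∸_; _^_; _<_; _≤_)
open import Data.Vec as V using (Vec; []; _∷_)
open import Data.List as L using (List; []; _∷_; filter; length; map; zipWith; replicate; foldr; concatMap)
open import Data.List.Relation.Unary.Any using (Any)
open import Data.List.Relation.Binary.Pointwise using (Pointwise)
open import Data.Product using (Σ; ∃; _×_; _,_)
open import Relation.Binary.PropositionalEquality using (_≡_)
open import Relation.Nullary using (¬_)
open import Relation.Unary using (Pred)
open import Relation.Nullary.Decidable using (Dec; yes; no)
open import Data.Bool.Properties using (T?)

-- F₂ is Bool (false = 0, true = 1, xor = +, ∧ = ·);  F₂ⁿ is Vec Bool n.
F₂ : Set
F₂ = Bool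

F₂^ : ℕ → Set
F₂^ n = Vec Bool n

𝟘 : (n : ℕ) → F₂^ n
𝟘 n = V.replicate n false

NonZeroVec : {n : ℕ} → F₂^ n → Set
NonZeroVec v = V.foldr _ (λ b r → b ≡ true Data.Sum.⊎ r) Data.Empty.⊥ v
  where import Data.Sum
        import Data.Empty

isNonZero : {n : ℕ} → F₂^ n → Bool
isNonZero v = V.foldr _ Data.Bool._∨_ false v
  where import Data.Bool

_·_ : {n : ℕ} → F₂^ n → F₂^ n → F₂
u · v = V.foldr _ _xor_ false (V.zipWith _∧_ u v)

_⊕_ : {n : ℕ} → F₂^ n → F₂^ n → F₂^ n
u ⊕ v = V.zipWith _xor_ u v

allVecs : (n : ℕ) → List (F₂^ n)
allVecs zero = [] ∷ []
allVecs (suc n) = L.map (false ∷_) (allVecs n) L.++ L.map (true ∷_) (allVecs n)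

-- enumeration of F₂ⁿ ∖ {0}: these index the coordinates of words of length 2ⁿ - 1
nonzeroVecs : (n : ℕ) → List (F₂^ n)
nonzeroVecs n = filter (λ v → T? (isNonZero v)) (allVecs n)

-- Hyperplanes of F₂ⁿ ((n-1)-dim. subspaces) are exactly the kernels
-- H_a = {x | a · x = 0} of nonzero a; we parametrize them by a.
InHyperplane : {n : ℕ} → F₂^ n → F₂^ n → Set
InHyperplane a x = a · x ≡ false

Subset : ℕ → Set
Subset n = F₂^ n → Bool

card : {n : ℕ} → Subset n → ℕ
card {n} S = length (filter (λ x → T? (S x)) (allVecs n))

-- Words of length 2ⁿ - 1 are lists of bits indexed by nonzeroVecs n.

Word : Set
Word = List F₂

cuv : {n : ℕ} → (F₂^ n → F₂) → F₂ → F₂^ n → Word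
cuv {n} f u v = L.map (λ x → (u ∧ f x) xor (v · x)) (nonzeroVecs n)

zeroWord : ℕ → Word
zeroWord n = L.map (λ _ → false) (nonzeroVecs n)

addWord : Word → Word → Word
addWord = zipWith _xor_

-- 𝒞_f = F₂-span of the c(u,v): over F₂ a linear combination is a sum of
-- finitely many generators (scalars are 0 or 1).
InCode : {n : ℕ} → (F₂^ n → F₂) → Word → Set
InCode {n} f w =
  Σ (List (F₂ × F₂^ n)) λ gens →
    w ≡ L.foldr (λ { (u , v) acc → addWord (cuv f u v) acc }) (zeroWord n) gens

NonZeroWord : Word → Set
NonZeroWord w = Any (λ b → b ≡ true) w

SuppSubset : Word → Word → Set
SuppSubset c c' = Pointwise (λ a b → a ≡ true → b ≡ true) c c'

weight : Word → ℕ
weight w = length (filter (λ b → T? b) w)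

-- Minimal code: for codewords c, c' with c nonzero, supp c ⊆ supp c'
-- implies c = λ c' for λ ∈ F₂^× = {1}, i.e. c = c'.
IsMinimalCode : {n : ℕ} → (F₂^ n → F₂) → Set
IsMinimalCode f =
  ∀ c c' → InCode f c → InCode f c' → NonZeroWord c →
    SuppSubset c c' → c ≡ c'

IsMinWeight : {n : ℕ} → (F₂^ n → F₂) → ℕ → Set
IsMinWeight f w =
  (Σ Word λ c → InCode f c × NonZeroWord c × weight c ≡ w) ×
  (∀ c → InCode f c → NonZeroWord c → w ≤ weight c)

IsMaxWeight : {n : ℕ} → (F₂^ n → F₂) → ℕ → Set
IsMaxWeight f w =
  (Σ Word λ c → InCode f c × NonZeroWord c × weight c ≡ w) ×
  (∀ c → InCode f c → NonZeroWord c → weight c ≤ w)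

-- Ashikhmin–Barg for q = 2:  w_max / w_min < 2/(2-1) = 2,
-- i.e. w_max < 2 · w_min (w_min > 0).
SatisfiesAB : {n : ℕ} → (F₂^ n → F₂) → Set
SatisfiesAB f =
  ∀ wmin wmax → IsMinWeight f wmin → IsMaxWeight f wmax → wmax < 2 * wmin

{-# OPTIONS --safe #-}
-- Every codeword is some c(u,v), since generators add as their parameters do.  Suppose
-- supp c(u,v) ⊆ supp c(u',v') with c(u,v) ≠ 0, and let d = n + 1 be the dimension.  Off S the
-- entries are v·x and v'·x, so if v ∉ {0, v'} the slab {v·x = 1, v'·x = 0} lies in S.  But it
-- has 2^(d-2) > |S| points: |A ∩ B| = (|A| + |B| - |A △ B|) / 2 for A = {v·x = 1} and
-- B = {v'·x = 0}, and A, B, A △ B = {(v + v')·x = 0} are cosets of hyperplanes, of size 2^(d-1).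
-- If v = v' but u ≠ u', or v = 0 ≠ v', the containment instead puts S on one side of a
-- hyperplane, which is impossible as S spans and blocks.  Ashikhmin–Barg fails because
-- w_min ≤ wt c(1,0) = |S| while w_max ≥ wt c(0,e) = 2^(d-1) > 2|S|.
module Submission where

open import Defs
open import Algebra.Bundles using (CommutativeRing)
open import Data.Bool using (Bool; true; false; not; _∧_; _xor_; T; if_then_else_)
open import Data.Bool.Properties
  using (T?; ∧-zeroʳ; ∧-identityʳ; ∧-distribʳ-xor; xor-identityʳ; xor-assoc; xor-comm; not-involutive;
         ¬-not; xor-∧-commutativeRing)
  renaming (_≟_ to _≟ᵇ_)
open import Data.Empty using (⊥; ⊥-elim)
open import Data.List as L using (List; []; _∷_; filter; length; map; zipWith; _++_)
open import Data.List.Extrema.Nat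
  using (argmin; argmax; argmin-all; argmax-all; f[argmin]≤f[xs]; f[xs]≤f[argmax])
open import Data.List.Membership.Propositional using (_∈_; lose)
open import Data.List.Membership.Propositional.Properties
  using (∈-map⁺; ∈-map⁻; ∈-++⁺ˡ; ∈-++⁺ʳ; ∈-filter⁺; ∈-filter⁻)
open import Data.List.Properties using (filter-++; length-++; map-cong)
open import Data.List.Relation.Binary.Pointwise using (Pointwise; _∷_)
import Data.List.Relation.Unary.All as All
open import Data.List.Relation.Unary.Any as Any using (Any; here; there; satisfied)
open import Data.List.Relation.Unary.Any.Properties using (map⁺; map⁻)
open import Data.Nat using (ℕ; zero; suc; _+_; _*_; _∸_; _^_; _<_; _≤_; z≤n; s≤s)
open import Data.Nat.Properties
  using (+-identityʳ; +-cancelˡ-≡; *-distribˡ-+; *-monoʳ-≤; *-monoʳ-<; +-mono-≤; ≤-refl; ≤-reflexive;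
         <⇒≤; <⇒≱; m≤n*m; +-commutativeSemigroup; module ≤-Reasoning)
open import Data.Product using (Σ; ∃; _×_; _,_; proj₁; proj₂; uncurry)
open import Data.Sum using (inj₁; inj₂)
open import Data.Vec as V using ([]; _∷_)
open import Data.Vec.Properties using (≡-dec)
open import Function using (_∘_)
open import Relation.Binary.Definitions using (DecidableEquality)
open import Relation.Binary.PropositionalEquality
open import Relation.Nullary using (¬_; yes; no)
open import Algebra.Properties.CommutativeSemigroup (CommutativeRing.+-commutativeSemigroup xor-∧-commutativeRing)
  using () renaming (interchange to xor-interchange)
open import Algebra.Properties.CommutativeSemigroup +-commutativeSemigroup
  using () renaming (interchange to +-interchange)

-- Vectors over F₂

xor-solve : ∀ u {p q} → u xor p ≡ q → p ≡ u xor q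
xor-solve false e = e
xor-solve true {p} e = trans (sym (not-involutive p)) (cong not e)

_≟ᵛ_ : ∀ {m} → DecidableEquality (F₂^ m)
_≟ᵛ_ = ≡-dec _≟ᵇ_

·-zeroˡ : ∀ {m} (x : F₂^ m) → 𝟘 m · x ≡ false
·-zeroˡ []      = refl
·-zeroˡ (_ ∷ x) = ·-zeroˡ x

·-zeroʳ : ∀ {m} (a : F₂^ m) → a · 𝟘 m ≡ false
·-zeroʳ []       = refl
·-zeroʳ (a₀ ∷ a) rewrite ∧-zeroʳ a₀ = ·-zeroʳ a

·-distribʳ-⊕ : ∀ {m} (a b x : F₂^ m) → (a ⊕ b) · x ≡ (a · x) xor (b · x)
·-distribʳ-⊕ []       []       []       = refl
·-distribʳ-⊕ (a₀ ∷ a) (b₀ ∷ b) (x₀ ∷ x) = begin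
  ((a₀ xor b₀) ∧ x₀) xor ((a ⊕ b) · x)
    ≡⟨ cong₂ _xor_ (∧-distribʳ-xor x₀ a₀ b₀) (·-distribʳ-⊕ a b x) ⟩
  ((a₀ ∧ x₀) xor (b₀ ∧ x₀)) xor ((a · x) xor (b · x))
    ≡⟨ xor-interchange (a₀ ∧ x₀) (b₀ ∧ x₀) (a · x) (b · x) ⟩
  ((a₀ ∧ x₀) xor (a · x)) xor ((b₀ ∧ x₀) xor (b · x)) ∎
  where open ≡-Reasoning

⊕-identityʳ : ∀ {m} (a : F₂^ m) → a ⊕ 𝟘 m ≡ a
⊕-identityʳ []       = refl
⊕-identityʳ (a₀ ∷ a) = cong₂ _∷_ (xor-identityʳ a₀) (⊕-identityʳ a)

⊕≡𝟘⇒≡ : ∀ {m} (a b : F₂^ m) → a ⊕ b ≡ 𝟘 m → a ≡ b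
⊕≡𝟘⇒≡ []          []          _ = refl
⊕≡𝟘⇒≡ (false ∷ a) (false ∷ b) e = cong (false ∷_) (⊕≡𝟘⇒≡ a b (cong V.tail e))
⊕≡𝟘⇒≡ (true ∷ a)  (true ∷ b)  e = cong (true ∷_) (⊕≡𝟘⇒≡ a b (cong V.tail e))
⊕≡𝟘⇒≡ (false ∷ a) (true ∷ b)  ()
⊕≡𝟘⇒≡ (true ∷ a)  (false ∷ b) ()

·≡true⇒≢𝟘 : ∀ {m} {a : F₂^ m} x → a · x ≡ true → a ≢ 𝟘 m
·≡true⇒≢𝟘 x ax≡1 refl with trans (sym (·-zeroˡ x)) ax≡1
... | ()

≢𝟘⇒NonZeroVec : ∀ {m} (a : F₂^ m) → a ≢ 𝟘 m → NonZeroVec a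
≢𝟘⇒NonZeroVec []          a≢𝟘 = ⊥-elim (a≢𝟘 refl)
≢𝟘⇒NonZeroVec (true ∷ a)  _   = inj₁ refl
≢𝟘⇒NonZeroVec (false ∷ a) a≢𝟘 = inj₂ (≢𝟘⇒NonZeroVec a (a≢𝟘 ∘ cong (false ∷_)))

≢𝟘⇒isNonZero : ∀ {m} (a : F₂^ m) → a ≢ 𝟘 m → isNonZero a ≡ true
≢𝟘⇒isNonZero []          a≢𝟘 = ⊥-elim (a≢𝟘 refl)
≢𝟘⇒isNonZero (true ∷ a)  _   = refl
≢𝟘⇒isNonZero (false ∷ a) a≢𝟘 = ≢𝟘⇒isNonZero a (a≢𝟘 ∘ cong (false ∷_))

∈-allVecs : ∀ {m} (x : F₂^ m) → x ∈ allVecs m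
∈-allVecs []                = here refl
∈-allVecs (false ∷ x)       = ∈-++⁺ˡ (∈-map⁺ (false ∷_) (∈-allVecs x))
∈-allVecs {suc m} (true ∷ x) = ∈-++⁺ʳ (map (false ∷_) (allVecs m)) (∈-map⁺ (true ∷_) (∈-allVecs x))

∈-nonzeroVecs : ∀ {m} {x : F₂^ m} → x ≢ 𝟘 m → x ∈ nonzeroVecs m
∈-nonzeroVecs {x = x} x≢𝟘 = ∈-filter⁺ (T? ∘ isNonZero) (∈-allVecs x) (subst T (sym (≢𝟘⇒isNonZero x x≢𝟘)) _)

-- Counting points of F₂ᵐ

count : ∀ {m} → (F₂^ m → Bool) → ℕ
count {zero}  P = if P [] then 1 else 0
count {suc m} P = count (P ∘ (false ∷_)) + count (P ∘ (true ∷_))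

count-cong : ∀ {m} {P Q : F₂^ m → Bool} → (∀ x → P x ≡ Q x) → count P ≡ count Q
count-cong {zero}  P≗Q rewrite P≗Q [] = refl
count-cong {suc m} P≗Q = cong₂ _+_ (count-cong (P≗Q ∘ (false ∷_))) (count-cong (P≗Q ∘ (true ∷_)))

count-mono : ∀ {m} {P Q : F₂^ m → Bool} → (∀ x → P x ≡ true → Q x ≡ true) → count P ≤ count Q
count-mono {zero} {P} {Q} P⇒Q with P [] | P⇒Q []
... | false | _   = z≤n
... | true  | Q[] rewrite Q[] refl = ≤-refl
count-mono {suc m} P⇒Q = +-mono-≤ (count-mono (P⇒Q ∘ (false ∷_))) (count-mono (P⇒Q ∘ (true ∷_)))

count-true : ∀ m → count {m} (λ _ → true) ≡ 2 ^ m
count-true zero    = refl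
count-true (suc m) = cong₂ _+_ (count-true m) (trans (count-true m) (sym (+-identityʳ _)))

count-false : ∀ m → count {m} (λ _ → false) ≡ 0
count-false zero    = refl
count-false (suc m) = cong₂ _+_ (count-false m) (count-false m)

count-xor+∧ : ∀ {m} (P Q : F₂^ m → Bool) →
  count P + count Q ≡ count (λ x → P x xor Q x) + 2 * count (λ x → P x ∧ Q x)
count-xor+∧ {zero} P Q with P [] | Q []
... | false | false = refl
... | false | true  = refl
... | true  | false = refl
... | true  | true  = refl
count-xor+∧ {suc m} P Q = begin
  (p₀ + p₁) + (q₀ + q₁)           ≡⟨ +-interchange p₀ p₁ q₀ q₁ ⟩
  (p₀ + q₀) + (p₁ + q₁)           ≡⟨ cong₂ _+_ (count-xor+∧ (P ∘ (false ∷_)) (Q ∘ (false ∷_)))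
                                                (count-xor+∧ (P ∘ (true ∷_)) (Q ∘ (true ∷_))) ⟩
  (r₀ + 2 * s₀) + (r₁ + 2 * s₁)   ≡⟨ +-interchange r₀ (2 * s₀) r₁ (2 * s₁) ⟩
  (r₀ + r₁) + (2 * s₀ + 2 * s₁)   ≡⟨ cong ((r₀ + r₁) +_) (sym (*-distribˡ-+ 2 s₀ s₁)) ⟩
  (r₀ + r₁) + 2 * (s₀ + s₁)       ∎
  where
  open ≡-Reasoning
  p₀ = count (P ∘ (false ∷_))
  p₁ = count (P ∘ (true ∷_))
  q₀ = count (Q ∘ (false ∷_))
  q₁ = count (Q ∘ (true ∷_))
  r₀ = count (λ x → P (false ∷ x) xor Q (false ∷ x))
  r₁ = count (λ x → P (true ∷ x) xor Q (true ∷ x))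
  s₀ = count (λ x → P (false ∷ x) ∧ Q (false ∷ x))
  s₁ = count (λ x → P (true ∷ x) ∧ Q (true ∷ x))

length-filter-map : ∀ {A B : Set} (P : B → Bool) (g : A → B) xs →
  length (filter (T? ∘ P) (map g xs)) ≡ length (filter (T? ∘ P ∘ g) xs)
length-filter-map P g []       = refl
length-filter-map P g (x ∷ xs) with P (g x)
... | true  = cong suc (length-filter-map P g xs)
... | false = length-filter-map P g xs

filter-absorb : ∀ {A : Set} (P Q : A → Bool) → (∀ x → Q x ≡ true → P x ≡ true) →
  ∀ xs → filter (T? ∘ Q) (filter (T? ∘ P) xs) ≡ filter (T? ∘ Q) xs
filter-absorb P Q Q⇒P []       = refl
filter-absorb P Q Q⇒P (x ∷ xs) with P x in Px
... | true  with Q x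
...   | true  = cong (x ∷_) (filter-absorb P Q Q⇒P xs)
...   | false = filter-absorb P Q Q⇒P xs
filter-absorb P Q Q⇒P (x ∷ xs) | false with Q x in Qx
...   | false = filter-absorb P Q Q⇒P xs
...   | true  with trans (sym (Q⇒P x Qx)) Px
...     | ()

card≡count : ∀ {m} (P : Subset m) → card P ≡ count P
card≡count {zero} P with P []
... | true  = refl
... | false = refl
card≡count {suc m} P = begin
  length (filter (T? ∘ P) (map (false ∷_) (allVecs m) ++ map (true ∷_) (allVecs m)))
    ≡⟨ cong length (filter-++ (T? ∘ P) (map (false ∷_) (allVecs m)) _) ⟩
  length (filter (T? ∘ P) (map (false ∷_) (allVecs m)) ++ filter (T? ∘ P) (map (true ∷_) (allVecs m)))
    ≡⟨ length-++ (filter (T? ∘ P) (map (false ∷_) (allVecs m))) ⟩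
  length (filter (T? ∘ P) (map (false ∷_) (allVecs m))) + length (filter (T? ∘ P) (map (true ∷_) (allVecs m)))
    ≡⟨ cong₂ _+_ (half false) (half true) ⟩
  count (P ∘ (false ∷_)) + count (P ∘ (true ∷_)) ∎
  where
  open ≡-Reasoning
  half : ∀ b → length (filter (T? ∘ P) (map (b ∷_) (allVecs m))) ≡ count (P ∘ (b ∷_))
  half b = trans (length-filter-map P (b ∷_) (allVecs m)) (card≡count (P ∘ (b ∷_)))

weight-map-nonzeroVecs : ∀ {m} (g : F₂^ m → Bool) → g (𝟘 m) ≡ false →
  weight (map g (nonzeroVecs m)) ≡ count g
weight-map-nonzeroVecs {m} g g𝟘 = begin
  weight (map g (nonzeroVecs m))
    ≡⟨ length-filter-map (λ b → b) g (nonzeroVecs m) ⟩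
  length (filter (T? ∘ g) (filter (T? ∘ isNonZero) (allVecs m)))
    ≡⟨ cong length (filter-absorb isNonZero g g⇒isNonZero (allVecs m)) ⟩
  length (filter (T? ∘ g) (allVecs m))
    ≡⟨ card≡count g ⟩
  count g ∎
  where
  open ≡-Reasoning
  g⇒isNonZero : ∀ x → g x ≡ true → isNonZero x ≡ true
  g⇒isNonZero x gx with x ≟ᵛ 𝟘 m
  ... | no x≢𝟘   = ≢𝟘⇒isNonZero x x≢𝟘
  ... | yes refl with trans (sym gx) g𝟘
  ...   | ()

-- Affine functionals

affine : ∀ {m} → F₂^ m → F₂ → F₂^ m → F₂
affine a α x = α xor (a · x)

affine-𝟘 : ∀ {m} α (x : F₂^ m) → affine (𝟘 m) α x ≡ α
affine-𝟘 α x = trans (cong (α xor_) (·-zeroˡ x)) (xor-identityʳ α)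

affine-⊕ : ∀ {m} (a b : F₂^ m) α β x → affine (a ⊕ b) (α xor β) x ≡ affine a α x xor affine b β x
affine-⊕ a b α β x = trans (cong ((α xor β) xor_) (·-distribʳ-⊕ a b x)) (xor-interchange α β (a · x) (b · x))

count-affine-∷ : ∀ {m} a₀ (a : F₂^ m) α →
  count (affine (a₀ ∷ a) α) ≡ count (affine a α) + count (affine a (α xor a₀))
count-affine-∷ a₀ a α = cong₂ _+_ (count-cong at-false) (count-cong at-true)
  where
  at-false : ∀ x → affine (a₀ ∷ a) α (false ∷ x) ≡ affine a α x
  at-false x = cong (λ t → α xor (t xor (a · x))) (∧-zeroʳ a₀)
  at-true : ∀ x → affine (a₀ ∷ a) α (true ∷ x) ≡ affine a (α xor a₀) x
  at-true x = trans (cong (λ t → α xor (t xor (a · x))) (∧-identityʳ a₀)) (sym (xor-assoc α a₀ (a · x)))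

count-affine : ∀ {m} (a : F₂^ (suc m)) α → a ≢ 𝟘 (suc m) → count (affine a α) ≡ 2 ^ m
count-affine {m} (a₀ ∷ a) α a≢𝟘 with a ≟ᵛ 𝟘 m
count-affine {m} (false ∷ a) α a≢𝟘 | yes refl = ⊥-elim (a≢𝟘 refl)
count-affine {m} (true ∷ a)  α a≢𝟘 | yes refl = begin
  count (affine (true ∷ 𝟘 m) α)
    ≡⟨ count-affine-∷ true (𝟘 m) α ⟩
  count (affine (𝟘 m) α) + count (affine (𝟘 m) (α xor true))
    ≡⟨ cong₂ _+_ (count-cong (affine-𝟘 {m} α)) (count-cong (affine-𝟘 {m} (α xor true))) ⟩
  count {m} (λ _ → α) + count {m} (λ _ → α xor true)
    ≡⟨ constant-halves α ⟩
  2 ^ m ∎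
  where
  open ≡-Reasoning
  constant-halves : ∀ α → count {m} (λ _ → α) + count {m} (λ _ → α xor true) ≡ 2 ^ m
  constant-halves true  = trans (cong₂ _+_ (count-true m) (count-false m)) (+-identityʳ _)
  constant-halves false = cong₂ _+_ (count-false m) (count-true m)
count-affine {zero}  (a₀ ∷ []) α _ | no a≢𝟘 = ⊥-elim (a≢𝟘 refl)
count-affine {suc m} (a₀ ∷ a) α _ | no a≢𝟘 = begin
  count (affine (a₀ ∷ a) α)
    ≡⟨ count-affine-∷ a₀ a α ⟩
  count (affine a α) + count (affine a (α xor a₀))
    ≡⟨ cong₂ _+_ (count-affine a α a≢𝟘) (count-affine a (α xor a₀) a≢𝟘) ⟩
  2 ^ m + 2 ^ m
    ≡⟨ cong (2 ^ m +_) (sym (+-identityʳ _)) ⟩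
  2 ^ suc m ∎
  where open ≡-Reasoning

count-affine∧affine : ∀ {m} (a b : F₂^ (suc m)) α β → a ≢ 𝟘 (suc m) → b ≢ 𝟘 (suc m) → a ≢ b →
  2 * count (λ x → affine a α x ∧ affine b β x) ≡ 2 ^ m
count-affine∧affine {m} a b α β a≢𝟘 b≢𝟘 a≢b = +-cancelˡ-≡ (2 ^ m) _ _ (begin
  2 ^ m + 2 * both
    ≡⟨ cong (_+ 2 * both) (count-affine (a ⊕ b) (α xor β) a⊕b≢𝟘) ⟨
  count (affine (a ⊕ b) (α xor β)) + 2 * both
    ≡⟨ cong (_+ 2 * both) (count-cong (affine-⊕ a b α β)) ⟩
  count (λ x → affine a α x xor affine b β x) + 2 * both
    ≡⟨ count-xor+∧ (affine a α) (affine b β) ⟨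
  count (affine a α) + count (affine b β)
    ≡⟨ cong₂ _+_ (count-affine a α a≢𝟘) (count-affine b β b≢𝟘) ⟩
  2 ^ m + 2 ^ m ∎)
  where
  open ≡-Reasoning
  both = count (λ x → affine a α x ∧ affine b β x)
  a⊕b≢𝟘 : a ⊕ b ≢ 𝟘 (suc m)
  a⊕b≢𝟘 = a≢b ∘ ⊕≡𝟘⇒≡ a b

count-slab : ∀ {m} (a b : F₂^ (suc m)) → a ≢ 𝟘 (suc m) → a ≢ b →
  2 ^ m ≤ 2 * count (λ x → a · x ∧ not (b · x))
count-slab {m} a b a≢𝟘 a≢b with b ≟ᵛ 𝟘 (suc m)
... | no b≢𝟘   = ≤-reflexive (sym (count-affine∧affine a b false true a≢𝟘 b≢𝟘 a≢b))
... | yes refl = begin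
  2 ^ m                                          ≤⟨ m≤n*m (2 ^ m) 2 ⟩
  2 * 2 ^ m                                      ≡⟨ cong (2 *_) (count-affine a false a≢𝟘) ⟨
  2 * count (λ x → a · x)                        ≡⟨ cong (2 *_) (count-cong λ x →
                                                      trans (sym (∧-identityʳ (a · x)))
                                                            (cong (λ t → a · x ∧ not t) (sym (·-zeroˡ x)))) ⟩
  2 * count (λ x → a · x ∧ not (𝟘 (suc m) · x))  ∎
  where open ≤-Reasoning

-- The code 𝒞_f

module _ {A : Set} {P : A → Set} (w : A → ℕ) (xs : List A)
         (complete : ∀ {x} → P x → x ∈ xs) (sound : ∀ {x} → x ∈ xs → P x)
         {x₀ : A} (Px₀ : P x₀) where

  min-attained : Σ A λ y → P y × (∀ x → P x → w y ≤ w x)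
  min-attained = argmin w x₀ xs , argmin-all w Px₀ (All.tabulate sound) ,
                 λ x Px → All.lookup (f[argmin]≤f[xs] {f = w} x₀ xs) (complete Px)

  max-attained : Σ A λ y → P y × (∀ x → P x → w x ≤ w y)
  max-attained = argmax w x₀ xs , argmax-all w Px₀ (All.tabulate sound) ,
                 λ x Px → All.lookup (f[xs]≤f[argmax] {f = w} x₀ xs) (complete Px)

zipWith-map-map : ∀ {A B C : Set} (k : B → B → C) (g h : A → B) xs →
  zipWith k (map g xs) (map h xs) ≡ map (λ x → k (g x) (h x)) xs
zipWith-map-map k g h []       = refl
zipWith-map-map k g h (x ∷ xs) = cong (k (g x) (h x) ∷_) (zipWith-map-map k g h xs)

Pointwise-map⇒∈ : ∀ {A B : Set} {R : B → B → Set} {g h : A → B} {xs} →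
  Pointwise R (map g xs) (map h xs) → ∀ {x} → x ∈ xs → R (g x) (h x)
Pointwise-map⇒∈ {xs = _ ∷ _} (r ∷ _)  (here refl) = r
Pointwise-map⇒∈ {xs = _ ∷ _} (_ ∷ rs) (there x∈)  = Pointwise-map⇒∈ rs x∈

module _ {n} (f : F₂^ n → F₂) where

  entry : F₂ → F₂^ n → F₂^ n → F₂
  entry u v x = (u ∧ f x) xor (v · x)

  entry-xor : ∀ u u' v v' x → entry u v x xor entry u' v' x ≡ entry (u xor u') (v ⊕ v') x
  entry-xor u u' v v' x = begin
    ((u ∧ f x) xor (v · x)) xor ((u' ∧ f x) xor (v' · x))
      ≡⟨ xor-interchange (u ∧ f x) (v · x) (u' ∧ f x) (v' · x) ⟩
    ((u ∧ f x) xor (u' ∧ f x)) xor ((v · x) xor (v' · x))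
      ≡⟨ cong₂ _xor_ (∧-distribʳ-xor (f x) u u') (·-distribʳ-⊕ v v' x) ⟨
    ((u xor u') ∧ f x) xor ((v ⊕ v') · x) ∎
    where open ≡-Reasoning

  addWord-cuv : ∀ u u' v v' → addWord (cuv f u v) (cuv f u' v') ≡ cuv f (u xor u') (v ⊕ v')
  addWord-cuv u u' v v' =
    trans (zipWith-map-map _xor_ (entry u v) (entry u' v') (nonzeroVecs n))
          (map-cong (entry-xor u u' v v') (nonzeroVecs n))

  zeroWord≡cuv : zeroWord n ≡ cuv f false (𝟘 n)
  zeroWord≡cuv = map-cong (λ x → sym (·-zeroˡ x)) (nonzeroVecs n)

  InCode⇒cuv : ∀ {c} → InCode f c → ∃ λ u → ∃ λ v → c ≡ cuv f u v
  InCode⇒cuv ([] , c≡) = false , 𝟘 n , trans c≡ zeroWord≡cuv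
  InCode⇒cuv ((u , v) ∷ gens , c≡) with InCode⇒cuv (gens , refl)
  ... | u' , v' , c'≡ =
    u xor u' , v ⊕ v' , trans c≡ (trans (cong (addWord (cuv f u v)) c'≡) (addWord-cuv u u' v v'))

  cuv∈code : ∀ u v → InCode f (cuv f u v)
  cuv∈code u v = (u , v) ∷ [] , (begin
    cuv f u v                                 ≡⟨ cong₂ (cuv f) (xor-identityʳ u) (⊕-identityʳ v) ⟨
    cuv f (u xor false) (v ⊕ 𝟘 n)             ≡⟨ addWord-cuv u false v (𝟘 n) ⟨
    addWord (cuv f u v) (cuv f false (𝟘 n))   ≡⟨ cong (addWord (cuv f u v)) zeroWord≡cuv ⟨
    addWord (cuv f u v) (zeroWord n)          ∎)
    where open ≡-Reasoning

  entry-𝟘ᵛ : ∀ u x → entry u (𝟘 n) x ≡ u ∧ f x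
  entry-𝟘ᵛ u x = trans (cong ((u ∧ f x) xor_) (·-zeroˡ x)) (xor-identityʳ _)

  module _ (f𝟘 : f (𝟘 n) ≡ false) where

    entry-𝟘 : ∀ u v → entry u v (𝟘 n) ≡ false
    entry-𝟘 u v rewrite f𝟘 | ∧-zeroʳ u = ·-zeroʳ v

    weight-cuv : ∀ u v → weight (cuv f u v) ≡ count (entry u v)
    weight-cuv u v = weight-map-nonzeroVecs (entry u v) (entry-𝟘 u v)

    supp-⊆ : ∀ {u v u' v'} → SuppSubset (cuv f u v) (cuv f u' v') →
      ∀ x → entry u v x ≡ true → entry u' v' x ≡ true
    supp-⊆ {u} {v} c⊆c' x cx with x ≟ᵛ 𝟘 n
    ... | no x≢𝟘   = Pointwise-map⇒∈ c⊆c' (∈-nonzeroVecs x≢𝟘) cx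
    ... | yes refl with trans (sym cx) (entry-𝟘 u v)
    ...   | ()

    NonZeroWord-cuv : ∀ {u v} x → entry u v x ≡ true → NonZeroWord (cuv f u v)
    NonZeroWord-cuv {u} {v} x cx = map⁺ (lose (∈-nonzeroVecs x≢𝟘) cx)
      where
      x≢𝟘 : x ≢ 𝟘 n
      x≢𝟘 refl with trans (sym cx) (entry-𝟘 u v)
      ... | ()

  NonZeroWord⇒entry : ∀ {u v} → NonZeroWord (cuv f u v) → ∃ λ x → entry u v x ≡ true
  NonZeroWord⇒entry = satisfied ∘ map⁻

  codewords : List Word
  codewords = map (λ uv → cuv f (V.head uv) (V.tail uv)) (allVecs (suc n))

  nonzeroCodewords : List Word
  nonzeroCodewords = filter (Any.any? (_≟ᵇ true)) codewords

  ∈-nonzeroCodewords⁺ : ∀ {c} → InCode f c × NonZeroWord c → c ∈ nonzeroCodewords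
  ∈-nonzeroCodewords⁺ (c∈ , c≢0) with InCode⇒cuv c∈
  ... | u , v , refl = ∈-filter⁺ (Any.any? (_≟ᵇ true)) (∈-map⁺ _ (∈-allVecs (u ∷ v))) c≢0

  ∈-nonzeroCodewords⁻ : ∀ {c} → c ∈ nonzeroCodewords → InCode f c × NonZeroWord c
  ∈-nonzeroCodewords⁻ c∈ with ∈-filter⁻ (Any.any? (_≟ᵇ true)) {xs = codewords} c∈
  ... | c∈codewords , c≢0 with ∈-map⁻ _ c∈codewords
  ...   | uv , _ , refl = cuv∈code (V.head uv) (V.tail uv) , c≢0

  minWeight-exists : ∀ {c₀} → InCode f c₀ → NonZeroWord c₀ → Σ ℕ (IsMinWeight f)
  minWeight-exists c₀∈ c₀≢0
    with min-attained weight nonzeroCodewords ∈-nonzeroCodewords⁺ ∈-nonzeroCodewords⁻ (c₀∈ , c₀≢0)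
  ... | c , (c∈ , c≢0) , c≤ = weight c , (c , c∈ , c≢0 , refl) , λ c' c'∈ c'≢0 → c≤ c' (c'∈ , c'≢0)

  maxWeight-exists : ∀ {c₀} → InCode f c₀ → NonZeroWord c₀ → Σ ℕ (IsMaxWeight f)
  maxWeight-exists c₀∈ c₀≢0
    with max-attained weight nonzeroCodewords ∈-nonzeroCodewords⁺ ∈-nonzeroCodewords⁻ (c₀∈ , c₀≢0)
  ... | c , (c∈ , c≢0) , ≤c = weight c , (c , c∈ , c≢0 , refl) , λ c' c'∈ c'≢0 → ≤c c' (c'∈ , c'≢0)

  2*weight≤weight⇒¬SatisfiesAB : ∀ {c₁ c₂} → InCode f c₁ → NonZeroWord c₁ → InCode f c₂ → NonZeroWord c₂ →
    2 * weight c₁ ≤ weight c₂ → ¬ SatisfiesAB f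
  2*weight≤weight⇒¬SatisfiesAB {c₁} {c₂} c₁∈ c₁≢0 c₂∈ c₂≢0 2c₁≤c₂ ab
    with minWeight-exists c₁∈ c₁≢0 | maxWeight-exists c₁∈ c₁≢0
  ... | wmin , isMin | wmax , isMax = <⇒≱ (ab wmin wmax isMin isMax) (begin
    2 * wmin       ≤⟨ *-monoʳ-≤ 2 (proj₂ isMin c₁ c₁∈ c₁≢0) ⟩
    2 * weight c₁  ≤⟨ 2c₁≤c₂ ⟩
    weight c₂      ≤⟨ proj₂ isMax c₂ c₂∈ c₂≢0 ⟩
    wmax           ∎)
    where open ≤-Reasoning

-- Minimality and the failure of the Ashikhmin–Barg condition

Spanning : ∀ {m} → Subset m → Set
Spanning S = ∀ a → NonZeroVec a → ¬ (∀ x → S x ≡ true → InHyperplane a x)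

Blocking : ∀ {m} → Subset m → Set
Blocking {m} S = ∀ a → NonZeroVec a → Σ (F₂^ m) λ x → S x ≡ true × InHyperplane a x

module Minimality {m} (S : Subset (suc m)) (S𝟘 : S (𝟘 (suc m)) ≡ false)
                  (spanning : Spanning S) (blocking : Blocking S) (small : 2 * card S < 2 ^ m) where

  S⊈level-set : ∀ {a} β → a ≢ 𝟘 (suc m) → ¬ (∀ x → S x ≡ true → a · x ≡ β)
  S⊈level-set {a} false a≢𝟘 = spanning a (≢𝟘⇒NonZeroVec a a≢𝟘)
  S⊈level-set {a} true  a≢𝟘 S⊆ with blocking a (≢𝟘⇒NonZeroVec a a≢𝟘)
  ... | x , Sx , ax≡0 with trans (sym ax≡0) (S⊆ x Sx)
  ...   | ()

  slab⊈S : ∀ {a b} → a ≢ 𝟘 (suc m) → a ≢ b →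
    ¬ (∀ x → a · x ≡ true → b · x ≡ false → S x ≡ true)
  slab⊈S {a} {b} a≢𝟘 a≢b slab⊆S = <⇒≱ small (begin
    2 ^ m                                  ≤⟨ count-slab a b a≢𝟘 a≢b ⟩
    2 * count (λ x → a · x ∧ not (b · x))  ≤⟨ *-monoʳ-≤ 2 (count-mono in-slab⇒S) ⟩
    2 * count S                            ≡⟨ cong (2 *_) (card≡count S) ⟨
    2 * card S                             ∎)
    where
    open ≤-Reasoning
    in-slab⇒S : ∀ x → a · x ∧ not (b · x) ≡ true → S x ≡ true
    in-slab⇒S x with a · x in ax | b · x in bx
    ... | true  | false = λ _ → slab⊆S x ax bx
    ... | true  | true  = λ ()
    ... | false | _     = λ ()

  entry-on-S : ∀ u v {x} → S x ≡ true → entry S u v x ≡ u xor (v · x)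
  entry-on-S u v Sx rewrite Sx | ∧-identityʳ u = refl

  entry-off-S : ∀ u v {x} → S x ≡ false → entry S u v x ≡ v · x
  entry-off-S u v Sx rewrite Sx | ∧-zeroʳ u = refl

  Supp⊆ : F₂ → F₂^ (suc m) → F₂ → F₂^ (suc m) → Set
  Supp⊆ u v u' v' = ∀ x → entry S u v x ≡ true → entry S u' v' x ≡ true

  ¬Supp⊆-different-v : ∀ {u v u' v'} → v ≢ v' → v ≢ 𝟘 (suc m) → ¬ Supp⊆ u v u' v'
  ¬Supp⊆-different-v {u} {v} {u'} {v'} v≢v' v≢𝟘 c⊆c' = slab⊈S v≢𝟘 v≢v' slab⊆S
    where
    slab⊆S : ∀ x → v · x ≡ true → v' · x ≡ false → S x ≡ true
    slab⊆S x vx v'x with S x in Sx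
    ... | true  = refl
    ... | false with trans (sym (entry-off-S u' v' Sx)) (c⊆c' x (trans (entry-off-S u v Sx) vx))
    ...   | v'x≡1 with trans (sym v'x) v'x≡1
    ...     | ()

  ¬Supp⊆-zero-v : ∀ {u u' v'} x₀ → v' ≢ 𝟘 (suc m) → entry S u (𝟘 (suc m)) x₀ ≡ true →
    ¬ Supp⊆ u (𝟘 (suc m)) u' v'
  ¬Supp⊆-zero-v {false} x₀ _ cx₀ _ with trans (sym (entry-𝟘ᵛ S false x₀)) cx₀
  ... | ()
  ¬Supp⊆-zero-v {true} {u'} {v'} x₀ v'≢𝟘 _ c⊆c' = S⊈level-set (u' xor true) v'≢𝟘 S⊆
    where
    S⊆ : ∀ x → S x ≡ true → v' · x ≡ u' xor true
    S⊆ x Sx = xor-solve u' (trans (sym (entry-on-S u' v' Sx)) (c⊆c' x (trans (entry-𝟘ᵛ S true x) Sx)))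

  ¬Supp⊆-same-v : ∀ {u u' v} x₀ → u ≢ u' → entry S u v x₀ ≡ true → ¬ Supp⊆ u v u' v
  ¬Supp⊆-same-v {u} {u'} {v} x₀ u≢u' cx₀ c⊆c' = S⊈level-set u v≢𝟘 S⊆
    where
    both-true : ∀ {p} → u xor p ≡ true → u' xor p ≡ true → ⊥
    both-true {p} e e' =
      u≢u' (trans (xor-solve p (trans (xor-comm p u) e)) (sym (xor-solve p (trans (xor-comm p u') e'))))
    on-S-false : ∀ {x} → S x ≡ true → entry S u v x ≡ true → ⊥
    on-S-false Sx cx = both-true (trans (sym (entry-on-S u v Sx)) cx) (trans (sym (entry-on-S u' v Sx)) (c⊆c' _ cx))
    x₀∉S : S x₀ ≡ false
    x₀∉S = ¬-not (λ Sx₀ → on-S-false Sx₀ cx₀)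
    v≢𝟘 : v ≢ 𝟘 (suc m)
    v≢𝟘 = ·≡true⇒≢𝟘 x₀ (trans (sym (entry-off-S u v x₀∉S)) cx₀)
    S⊆ : ∀ x → S x ≡ true → v · x ≡ u
    S⊆ x Sx = trans (xor-solve u (trans (sym (entry-on-S u v Sx)) (¬-not (on-S-false Sx)))) (xor-identityʳ u)

  Supp⊆⇒≡ : ∀ {u v u' v'} x₀ → entry S u v x₀ ≡ true → Supp⊆ u v u' v' → u ≡ u' × v ≡ v'
  Supp⊆⇒≡ {u} {v} {u'} {v'} x₀ cx₀ c⊆c' with v ≟ᵛ v' | v ≟ᵛ 𝟘 (suc m)
  ... | no v≢v' | no v≢𝟘  = ⊥-elim (¬Supp⊆-different-v {u} {v} {u'} {v'} v≢v' v≢𝟘 c⊆c')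
  ... | no v≢v' | yes refl = ⊥-elim (¬Supp⊆-zero-v {u} {u'} {v'} x₀ (v≢v' ∘ sym) cx₀ c⊆c')
  ... | yes refl | _ with u ≟ᵇ u'
  ...   | yes u≡u' = u≡u' , refl
  ...   | no u≢u'  = ⊥-elim (¬Supp⊆-same-v {u} {u'} {v} x₀ u≢u' cx₀ c⊆c')

  isMinimalCode : IsMinimalCode S
  isMinimalCode c c' c∈ c'∈ c≢0 c⊆c' with InCode⇒cuv S c∈ | InCode⇒cuv S c'∈
  ... | u , v , refl | u' , v' , refl with NonZeroWord⇒entry S {u} {v} c≢0
  ...   | x₀ , cx₀ =
    uncurry (cong₂ (cuv S)) (Supp⊆⇒≡ {u} {v} {u'} {v'} x₀ cx₀ (supp-⊆ S S𝟘 {u} {v} {u'} {v'} c⊆c'))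

small-indicator⇒¬SatisfiesAB : ∀ {m} (S : Subset (suc m)) → S (𝟘 (suc m)) ≡ false → ∀ {x₁} → S x₁ ≡ true →
  2 * card S ≤ 2 ^ m → ¬ SatisfiesAB S
small-indicator⇒¬SatisfiesAB {m} S S𝟘 {x₁} Sx₁ bound =
  2*weight≤weight⇒¬SatisfiesAB S
    (cuv∈code S true (𝟘 (suc m))) indicator≢0 (cuv∈code S false e) functional≢0 (begin
    2 * weight (cuv S true (𝟘 (suc m)))  ≡⟨ cong (2 *_) weight-indicator ⟩
    2 * card S                           ≤⟨ bound ⟩
    2 ^ m                                ≡⟨ weight-functional ⟨
    weight (cuv S false e)               ∎)
  where
  open ≤-Reasoning
  e : F₂^ (suc m)
  e = true ∷ 𝟘 m
  indicator≢0 : NonZeroWord (cuv S true (𝟘 (suc m)))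
  indicator≢0 = NonZeroWord-cuv S S𝟘 {true} {𝟘 (suc m)} x₁ (trans (entry-𝟘ᵛ S true x₁) Sx₁)
  functional≢0 : NonZeroWord (cuv S false e)
  functional≢0 = NonZeroWord-cuv S S𝟘 {false} {e} e (cong not (·-zeroˡ (𝟘 m)))
  weight-indicator : weight (cuv S true (𝟘 (suc m))) ≡ card S
  weight-indicator =
    trans (weight-cuv S S𝟘 true (𝟘 (suc m))) (trans (count-cong (entry-𝟘ᵛ S true)) (sym (card≡count S)))
  weight-functional : weight (cuv S false e) ≡ 2 ^ m
  weight-functional = trans (weight-cuv S S𝟘 false e) (count-affine e false λ ())

m<2^[n∸1]⇒2*m<2^n : ∀ {m} n → m < 2 ^ (n ∸ 1) → 2 * m < 2 ^ n
m<2^[n∸1]⇒2*m<2^n zero    (s≤s z≤n) = s≤s z≤n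
m<2^[n∸1]⇒2*m<2^n (suc n) m<2ⁿ      = *-monoʳ-< 2 m<2ⁿ

corollary1 : (n : ℕ) → (S : Subset (suc n)) →
    S (𝟘 (suc n)) ≡ false →
    (∀ a → NonZeroVec a → ¬ (∀ x → S x ≡ true → InHyperplane a x)) →
    (∀ a → NonZeroVec a → Σ (F₂^ (suc n)) λ x → S x ≡ true × InHyperplane a x) →
    card S < 2 ^ (suc n ∸ 2) →
    IsMinimalCode S × ¬ SatisfiesAB S
corollary1 n S S𝟘 spanning blocking small =
    Minimality.isMinimalCode S S𝟘 spanning blocking 2|S|<2ⁿ
  , small-indicator⇒¬SatisfiesAB S S𝟘 (proj₁ (proj₂ (blocking (true ∷ 𝟘 n) (inj₁ refl)))) (<⇒≤ 2|S|<2ⁿ)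
  where
  2|S|<2ⁿ : 2 * card S < 2 ^ n
  2|S|<2ⁿ = m<2^[n∸1]⇒2*m<2^n n small
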